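{- Let $\mathbb{S}$ be a semifield of order $q^n$ with centre containing $\mathbb{F}_q$, represented on $\mathbb{F}_{q^n}$. Then $\mathrm{trk}(\mathbb{S}) \geq \mathrm{mrk}([\mathbb{S}])$.
   Context: An $n$-dimensional algebra over $\mathbb{F}_q$ is $\mathbb{F}_{q^n}$ with $\mathbb{F}_q$-bilinear multiplication written uniquely as $\mathbb{S}(x,y)=\sum_{i,j=0}^{n-1}c_{ij}x^{q^i}y^{q^j}$, $c_{ij}\in\mathbb{F}_{q^n}$; $M(\mathbb{S})\in M_n(\mathbb{F}_{q^n})$ has $(i,j)$-entry $c_{ij}$ and $\mathrm{mrk}(\mathbb{S})=\mathrm{rank}(M(\mathbb{S}))$ over $\mathbb{F}_{q^n}$. Algebras $\mathbb{S},\mathbb{S}'$ on $\mathbb{F}_{q^n}$ are isotopic if $\mathbb{S}'(F(x),G(y))=H(\mathbb{S}(x,y))$ for invertible $\mathbb{F}_q$-linear $F,G,H$; $[\mathbb{S}]$ is the set of algebras isotopic to $\mathbb{S}$ and $\mathrm{mrk}([\mathbb{S}])=\min\{\mathrm{mrk}(\mathbb{T}):\mathbb{T}\in[\mathbb{S}]\}$. With $\mathrm{Tr}$ the trace $\mathbb{F}_{q^n}\to\mathbb{F}_q$, the tensor rank $\mathrm{trk}(\mathbb{S})$ is the least $N$ such that $\mathbb{S}(x,y)=\sum_{k=1}^N\mathrm{Tr}(a_kx)\mathrm{Tr}(b_ky)c_k$ for all $x,y$, for some $a_k,b_k,c_k\in\mathbb{F}_{q^n}$ (the tensor rank of the corresponding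 tensor in $V^\vee\otimes V^\vee\otimes V$, $V=V(n,q)$). -}

module Defs where

open import Data.Nat using (ℕ; zero; suc) renaming (_^_ to _^ℕ_)
open import Data.Fin using (Fin; zero; suc)
open import Data.Product using (Σ; _×_; _,_; ∃)
open import Data.Sum using (_⊎_)
open import Relation.Binary.PropositionalEquality using (_≡_)
open import Relation.Nullary using (¬_)
open import Algebra.Core using (Op₁; Op₂)
open import Algebra.Structures using (IsCommutativeRing)

record Field : Set₁ where
  infixl 6 _+_
  infixl 7 _*_
  field
    Carrier : Set
    _+_ _*_ : Op₂ Carrier
    -_      : Op₁ Carrier
    0# 1#   : Carrier
    isCommutativeRing : IsCommutativeRing _≡_ _+_ _*_ -_ 0# 1#
    0≢1     : ¬ (0# ≡ 1#)
    inverse : ∀ x → ¬ (x ≡ 0#) → Σ Carrier (λ y → x * y ≡ 1#)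

module FieldNotions (K : Field) (q n : ℕ) where
  open Field K

  _^_ : Carrier → ℕ → Carrier
  x ^ zero  = 1#
  x ^ suc m = x * (x ^ m)

  Σ[_] : (m : ℕ) → (Fin m → Carrier) → Carrier
  Σ[ zero ]  f = 0#
  Σ[ suc m ] f = f zero + Σ[ m ] (λ i → f (suc i))

  frob : ℕ → Carrier → Carrier
  frob i x = x ^ (q ^ℕ i)

  InFq : Carrier → Set
  InFq a = a ^ q ≡ a

  Tr : Carrier → Carrier
  Tr x = Σ[ n ] (λ i → frob (Data.Fin.toℕ i) x)

  IsFqLinear : (Carrier → Carrier) → Set
  IsFqLinear F = (∀ x y → F (x + y) ≡ F x + F y)
               × (∀ a x → InFq a → F (a * x) ≡ a * F x)

  IsInvertibleFqLinear : (Carrier → Carrier) → Set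
  IsInvertibleFqLinear F = IsFqLinear F
    × Σ (Carrier → Carrier) (λ G → (∀ x → G (F x) ≡ x) × (∀ y → F (G y) ≡ y))

  -- an algebra on F_{q^n}: an F_q-bilinear multiplication
  IsFqBilinear : (Carrier → Carrier → Carrier) → Set
  IsFqBilinear S = (∀ x y z → S (x + y) z ≡ S x z + S y z)
                 × (∀ x y z → S x (y + z) ≡ S x y + S x z)
                 × (∀ a x y → InFq a → S (a * x) y ≡ a * S x y)
                 × (∀ a x y → InFq a → S x (a * y) ≡ a * S x y)

  IsSemifield : (Carrier → Carrier → Carrier) → Set
  IsSemifield S = IsFqBilinear S
    × Σ Carrier (λ e → (∀ x → S e x ≡ x) × (∀ x → S x e ≡ x))
    × (∀ x y → S x y ≡ 0# → (x ≡ 0#) ⊎ (y ≡ 0#))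

  Isotopic : (S S' : Carrier → Carrier → Carrier) → Set
  Isotopic S S' = Σ (Carrier → Carrier) λ F → Σ (Carrier → Carrier) λ G → Σ (Carrier → Carrier) λ H →
    IsInvertibleFqLinear F × IsInvertibleFqLinear G × IsInvertibleFqLinear H
    × (∀ x y → S' (F x) (G y) ≡ H (S x y))

  -- M is the coefficient matrix of S: S(x,y) = Σ_{i,j} c_ij x^{q^i} y^{q^j}
  -- (for an algebra this matrix is unique)
  IsCoeffMatrix : (Carrier → Carrier → Carrier) → (Fin n → Fin n → Carrier) → Set
  IsCoeffMatrix S c = ∀ x y →
    S x y ≡ Σ[ n ] (λ i → Σ[ n ] (λ j →
      c i j * (frob (Data.Fin.toℕ i) x * frob (Data.Fin.toℕ j) y)))

  -- rank over F_{q^n} at most N: the row space is spanned by N vectors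
  RankAtMost : (Fin n → Fin n → Carrier) → ℕ → Set
  RankAtMost c N = Σ (Fin N → Fin n → Carrier) λ v → Σ (Fin n → Fin N → Carrier) λ λ′ →
    ∀ i j → c i j ≡ Σ[ N ] (λ k → λ′ i k * v k j)

  MrkAtMost : (Carrier → Carrier → Carrier) → ℕ → Set
  MrkAtMost S N = Σ (Fin n → Fin n → Carrier) λ c → IsCoeffMatrix S c × RankAtMost c N

  ClassMrkAtMost : (Carrier → Carrier → Carrier) → ℕ → Set
  ClassMrkAtMost S N = Σ (Carrier → Carrier → Carrier) λ T → Isotopic S T × MrkAtMost T N

  HasTensorDecomposition : (Carrier → Carrier → Carrier) → ℕ → Set
  HasTensorDecomposition S N =
    Σ (Fin N → Carrier) λ a → Σ (Fin N → Carrier) λ b → Σ (Fin N → Carrier) λ c →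
      ∀ x y → S x y ≡ Σ[ N ] (λ k → (Tr (a k * x) * Tr (b k * y)) * c k)

module Submission where

-- Suppose S(x,y) = Σₖ Tr(aₖx) Tr(bₖy) cₖ (k < N).  Since Tr(z) = Σᵢ z^{qⁱ} and the
-- Frobenius maps z ↦ z^{qⁱ} are multiplicative, expanding both traces gives
--     S(x,y) = Σᵢ Σⱼ Mᵢⱼ x^{qⁱ} y^{qʲ},   Mᵢⱼ = Σₖ (cₖ aₖ^{qⁱ}) bₖ^{qʲ},
-- so the coefficient matrix of S factors as M = L·V with L of size n×N and V of
-- size N×n; hence mrk(S) ≤ N.  As S lies in its own isotopy class (take
-- F = G = H = id), mrk([S]) ≤ N.

open import Defs
open import Data.Nat using (ℕ; zero; suc; _≤_; _^_)
open import Data.Fin using (Fin; zero; suc; toℕ)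
open import Data.Product using (_,_)
open import Function.Bundles using (_↔_)
open import Level using (0ℓ)
open import Relation.Binary.PropositionalEquality
open import Algebra.Bundles using (CommutativeRing)
import Algebra.Properties.CommutativeSemigroup as CommutativeSemigroupProperties
import Algebra.Properties.Semiring.Sum as SemiringSum

module TensorRankBound (K : Field) (q n : ℕ) where
  open Field K
  open FieldNotions K q n renaming (_^_ to _^ᴷ_)
  open ≡-Reasoning

  -- K as a library commutative ring, so that its summation lemmas apply.
  ring : CommutativeRing 0ℓ 0ℓ
  ring = record { Carrier = Carrier ; _≈_ = _≡_ ; _+_ = _+_ ; _*_ = _*_ ; -_ = -_
                ; 0# = 0# ; 1# = 1# ; isCommutativeRing = isCommutativeRing }

  open CommutativeRing ring using (*-assoc; *-comm; *-identityˡ; *-commutativeSemigroup)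
  open CommutativeSemigroupProperties *-commutativeSemigroup using (interchange)
  open SemiringSum (CommutativeRing.semiring ring)
    using (sum; sum-cong-≗; ∑-comm; *-distribˡ-sum; *-distribʳ-sum)

  Σ≡sum : ∀ m (f : Fin m → Carrier) → Σ[ m ] f ≡ sum f
  Σ≡sum zero    f = refl
  Σ≡sum (suc m) f = cong (f zero +_) (Σ≡sum m (λ i → f (suc i)))

  Σ²≡sum² : ∀ m k (f : Fin m → Fin k → Carrier) →
            Σ[ m ] (λ i → Σ[ k ] (f i)) ≡ sum (λ i → sum (f i))
  Σ²≡sum² m k f = trans (Σ≡sum m _) (sum-cong-≗ (λ i → Σ≡sum k (f i)))

  ^-distrib-* : ∀ a x m → (a * x) ^ᴷ m ≡ (a ^ᴷ m) * (x ^ᴷ m)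
  ^-distrib-* a x zero    = sym (*-identityˡ 1#)
  ^-distrib-* a x (suc m) = begin
    (a * x) * ((a * x) ^ᴷ m)       ≡⟨ cong ((a * x) *_) (^-distrib-* a x m) ⟩
    (a * x) * (a ^ᴷ m * x ^ᴷ m)    ≡⟨ interchange a x (a ^ᴷ m) (x ^ᴷ m) ⟩
    (a * a ^ᴷ m) * (x * x ^ᴷ m)    ∎

  frob-* : ∀ i a x → frob i (a * x) ≡ frob i a * frob i x
  frob-* i a x = ^-distrib-* a x (q ^ i)

  sum-*-sum : ∀ {m k} (f : Fin m → Carrier) (g : Fin k → Carrier) c →
              (sum f * sum g) * c ≡ sum (λ i → sum (λ j → (f i * g j) * c))
  sum-*-sum {m} f g c = begin
    (sum f * sum g) * c
      ≡⟨ cong (_* c) (*-distribʳ-sum (sum g) f) ⟩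
    sum (λ i → f i * sum g) * c
      ≡⟨ *-distribʳ-sum c (λ i → f i * sum g) ⟩
    sum (λ i → (f i * sum g) * c)
      ≡⟨ sum-cong-≗ {m} (λ i → cong (_* c) (*-distribˡ-sum (f i) g)) ⟩
    sum (λ i → sum (λ j → f i * g j) * c)
      ≡⟨ sum-cong-≗ {m} (λ i → *-distribʳ-sum c (λ j → f i * g j)) ⟩
    sum (λ i → sum (λ j → (f i * g j) * c)) ∎

  regroup : ∀ A X B Y C → ((A * X) * (B * Y)) * C ≡ ((C * A) * B) * (X * Y)
  regroup A X B Y C = begin
    ((A * X) * (B * Y)) * C     ≡⟨ cong (_* C) (interchange A X B Y) ⟩
    ((A * B) * (X * Y)) * C     ≡⟨ *-comm _ C ⟩
    C * ((A * B) * (X * Y))     ≡⟨ sym (*-assoc C (A * B) (X * Y)) ⟩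
    (C * (A * B)) * (X * Y)     ≡⟨ cong (_* (X * Y)) (sym (*-assoc C A B)) ⟩
    ((C * A) * B) * (X * Y)     ∎

  φ : Fin n → Carrier → Carrier
  φ i = frob (toℕ i)

  rankOne-expansion : ∀ a b c x y →
    (Tr (a * x) * Tr (b * y)) * c
      ≡ sum (λ i → sum (λ j → ((c * φ i a) * φ j b) * (φ i x * φ j y)))
  rankOne-expansion a b c x y = begin
    (Tr (a * x) * Tr (b * y)) * c
      ≡⟨ cong₂ (λ u v → (u * v) * c) (Σ≡sum n _) (Σ≡sum n _) ⟩
    (sum (λ i → φ i (a * x)) * sum (λ j → φ j (b * y))) * c
      ≡⟨ sum-*-sum (λ i → φ i (a * x)) (λ j → φ j (b * y)) c ⟩
    sum (λ i → sum (λ j → (φ i (a * x) * φ j (b * y)) * c))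
      ≡⟨ sum-cong-≗ {n} (λ i → sum-cong-≗ {n} (λ j → begin
           (φ i (a * x) * φ j (b * y)) * c
             ≡⟨ cong₂ (λ u v → (u * v) * c) (frob-* (toℕ i) a x) (frob-* (toℕ j) b y) ⟩
           ((φ i a * φ i x) * (φ j b * φ j y)) * c
             ≡⟨ regroup _ _ _ _ c ⟩
           ((c * φ i a) * φ j b) * (φ i x * φ j y) ∎)) ⟩
    sum (λ i → sum (λ j → ((c * φ i a) * φ j b) * (φ i x * φ j y))) ∎

  mrk≤tensorLength : ∀ S N → HasTensorDecomposition S N → MrkAtMost S N
  mrk≤tensorLength S N (a , b , c , decomposition) =
    M , isCoeff , (V , L , λ _ _ → refl)
    where
      L : Fin n → Fin N → Carrier
      L i k = c k * φ i (a k)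
      V : Fin N → Fin n → Carrier
      V k j = φ j (b k)
      M : Fin n → Fin n → Carrier
      M i j = Σ[ N ] (λ k → L i k * V k j)

      isCoeff : IsCoeffMatrix S M
      isCoeff x y = begin
        S x y
          ≡⟨ decomposition x y ⟩
        Σ[ N ] (λ k → (Tr (a k * x) * Tr (b k * y)) * c k)
          ≡⟨ Σ≡sum N _ ⟩
        sum (λ k → (Tr (a k * x) * Tr (b k * y)) * c k)
          ≡⟨ sum-cong-≗ {N} (λ k → rankOne-expansion (a k) (b k) (c k) x y) ⟩
        sum (λ k → sum (λ i → sum (λ j → (L i k * V k j) * X i j)))
          ≡⟨ ∑-comm {N} {n} _ ⟩
        sum (λ i → sum (λ k → sum (λ j → (L i k * V k j) * X i j)))
          ≡⟨ sum-cong-≗ {n} (λ i → ∑-comm {N} {n} _) ⟩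
        sum (λ i → sum (λ j → sum (λ k → (L i k * V k j) * X i j)))
          ≡⟨ sum-cong-≗ {n} (λ i → sum-cong-≗ {n} (λ j → sym (factor-entry i j))) ⟩
        sum (λ i → sum (λ j → M i j * X i j))
          ≡⟨ sym (Σ²≡sum² n n _) ⟩
        Σ[ n ] (λ i → Σ[ n ] (λ j → M i j * X i j)) ∎
        where
          X : Fin n → Fin n → Carrier
          X i j = φ i x * φ j y

          factor-entry : ∀ i j → M i j * X i j ≡ sum (λ k → (L i k * V k j) * X i j)
          factor-entry i j = trans (cong (_* X i j) (Σ≡sum N _))
                                   (*-distribʳ-sum (X i j) (λ k → L i k * V k j))

  id-invertible : IsInvertibleFqLinear (λ x → x)
  id-invertible = ((λ _ _ → refl) , (λ _ _ _ → refl)) , (λ x → x) , (λ _ → refl) , (λ _ → refl)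

  isotopic-refl : ∀ S → Isotopic S S
  isotopic-refl S = (λ x → x) , (λ x → x) , (λ x → x) ,
                    id-invertible , id-invertible , id-invertible , (λ _ _ → refl)

mainTheorem12 : (q n : ℕ) → 1 ≤ n → (K : Field) → (Field.Carrier K ↔ Fin (q ^ n))
    → (S : Field.Carrier K → Field.Carrier K → Field.Carrier K)
    → FieldNotions.IsSemifield K q n S
    → ∀ N → FieldNotions.HasTensorDecomposition K q n S N
    → FieldNotions.ClassMrkAtMost K q n S N
mainTheorem12 q n _ K _ S _ N decomposition =
  S , isotopic-refl S , mrk≤tensorLength S N decomposition
  where open TensorRankBound K q n
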